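{- Let $\mathcal{P},\mathcal{Q}$ be finite posets and $\phi:\mathcal{P}\to\mathcal{Q}$ a surjective order-preserving map. Then $\mathcal{I}_\phi(\mathcal{P})$ is a subalgebra of $\mathcal{I}(\mathcal{P})$, and $\phi_\ast:\mathcal{I}_\phi(\mathcal{P})\to\mathcal{I}(\mathcal{Q})$ is an algebra map; in particular $\phi_\ast(g\ast h)=\phi_\ast g\ast\phi_\ast h$ for all $g,h\in\mathcal{I}_\phi(\mathcal{P})$.
   Context: The incidence algebra $\mathcal{I}(\mathcal{P})$ of a finite poset $(\mathcal{P},\preceq)$ is the vector space of functions $h:\mathcal{P}\times\mathcal{P}\to\mathbb{C}$ with $h(a,c)=0$ unless $a\preceq c$, with product $(g\ast h)(a,c)=\sum_{a\preceq b\preceq c}g(a,b)h(b,c)$ and unit $\delta$ ($\delta(a,c)=1$ if $a=c$, else $0$). The pushforward $\phi_\ast:\mathcal{I}(\mathcal{P})\to\mathcal{I}(\mathcal{Q})$ is $\phi_\ast h(q,q')=\frac{1}{|\phi^{ -1}(q')|}\sum_{p\in\phi^{ -1}(q),\,p'\in\phi^{ -1}(q')}h(p,p')$. $\mathcal{I}_\phi(\mathcal{P})$ is the subspace of those $h\in\mathcal{I}(\mathcal{P})$ such that for all $q,q'\in\mathcal{Q}$ and all $p_1',p_2'\in\phi^{ -1}(q')$: $\sum_{p\in\phi^{ -1}(q)}h(p,p_1')=\sum_{p\in\phi^{ -1}(q)}h(p,p_2')$. -}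

module Defs where

open import Level using (Level; _⊔_; suc; 0ℓ)
open import Data.Nat using (ℕ; zero) renaming (suc to sucℕ; _+_ to _+ℕ_)
open import Data.Fin using (Fin) renaming (zero to fz; suc to fs)
open import Data.Fin.Properties using (_≟_)
open import Data.Product using (_×_; _,_; Σ)
open import Relation.Nullary using (¬_; Dec; yes; no)
open import Relation.Nullary.Decidable using (_×-dec_)
open import Relation.Binary using (Rel; Decidable)
open import Relation.Binary.PropositionalEquality using (_≡_)
open import Algebra.Bundles using (CommutativeRing)

module _ {c ℓ} (R : CommutativeRing c ℓ) where
  open CommutativeRing R
  natCast : ℕ → Carrier
  natCast zero = 0#
  natCast (sucℕ n) = 1# + natCast n

-- A field of characteristic zero (ℂ is one).  The inverse is a total
-- function, only constrained on nonzero elements (as in Lean/Mathlib).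
record CharZeroField (c ℓ : Level) : Set (Level.suc (c ⊔ ℓ)) where
  field
    commutativeRing : CommutativeRing c ℓ
  open CommutativeRing commutativeRing
  field
    _⁻¹       : Carrier → Carrier
    0≉1       : ¬ (0# ≈ 1#)
    ⁻¹-inverse : ∀ x → ¬ (x ≈ 0#) → (x * (x ⁻¹)) ≈ 1#
    char-zero : ∀ n → ¬ (natCast commutativeRing (sucℕ n) ≈ 0#)
  open CommutativeRing commutativeRing public

module Incidence {c ℓ} (F : CharZeroField c ℓ) where
  open CharZeroField F

  ∑ : ∀ {m} → (Fin m → Carrier) → Carrier
  ∑ {zero} f = 0#
  ∑ {sucℕ m} f = f fz + ∑ (λ i → f (fs i))

  count : ∀ {m} {P : Fin m → Set} → (∀ i → Dec (P i)) → ℕ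
  count {zero} d = 0
  count {sucℕ m} d with d fz
  ... | yes _ = sucℕ (count (λ i → d (fs i)))
  ... | no _ = count (λ i → d (fs i))

  when : ∀ {p} {P : Set p} → Dec P → Carrier → Carrier
  when (yes _) x = x
  when (no _) x = 0#

  Fun : ℕ → Set c
  Fun m = Fin m → Fin m → Carrier

  _≋_ : ∀ {m} → Fun m → Fun m → Set ℓ
  f ≋ g = ∀ a b → f a b ≈ g a b

  zeroF : ∀ {m} → Fun m
  zeroF a b = 0#

  _⊕_ : ∀ {m} → Fun m → Fun m → Fun m
  (f ⊕ g) a b = f a b + g a b

  _·_ : ∀ {m} → Carrier → Fun m → Fun m
  (k · f) a b = k * f a b

  InI : ∀ {m} → Rel (Fin m) 0ℓ → Fun m → Set ℓ
  InI _≼_ h = ∀ a c → ¬ (a ≼ c) → h a c ≈ 0#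

  δ : ∀ {m} → Fun m
  δ a c = when (a ≟ c) 1#

  conv : ∀ {m} {_≼_ : Rel (Fin m) 0ℓ} → Decidable _≼_ → Fun m → Fun m → Fun m
  conv _≼?_ g h a c = ∑ (λ b → when ((a ≼? b) ×-dec (b ≼? c)) (g a b * h b c))

  fiberSize : ∀ {m n} → (Fin m → Fin n) → Fin n → ℕ
  fiberSize φ q = count (λ p → φ p ≟ q)

  push : ∀ {m n} → (Fin m → Fin n) → Fun m → Fun n
  push φ h q q' =
    (natCast commutativeRing (fiberSize φ q') ⁻¹)
      * ∑ (λ p → ∑ (λ p' → when (φ p ≟ q) (when (φ p' ≟ q') (h p p'))))

  InIφ : ∀ {m n} → Rel (Fin m) 0ℓ → (Fin m → Fin n) → Fun m → Set ℓ
  InIφ _≼_ φ h =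
    InI _≼_ h ×
    (∀ q q' p₁ p₂ → φ p₁ ≡ q' → φ p₂ ≡ q' →
       ∑ (λ p → when (φ p ≟ q) (h p p₁)) ≈ ∑ (λ p → when (φ p ≟ q) (h p p₂)))

-- Write S h q p = Σ_{p' ∈ φ⁻¹(q)} h(p', p) (fiberSum).  Then I_φ(P) consists of the h ∈ I(P)
-- for which S h q is constant on every fiber of φ, and for such h the pushforward is simply
-- φ_* h (q, φ p) = S h q p.  S is linear, S δ q p = [φ p = q], and, when S g q is constant on
-- fibers, grouping the middle index of a product by its fiber gives
-- S (g ∗ h) q p = Σ_{q''} S g q p'' · S h q'' p  with any p'' ∈ φ⁻¹(q'').
-- So both closure of I_φ(P) and multiplicativity of φ_* reduce to these identities for S,
-- and φ_* h lands in I(Q) because φ is monotone.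

module Submission where

open import Defs
open import Level using (0ℓ)
open import Data.Nat using (ℕ; zero; suc)
open import Data.Fin using (Fin) renaming (zero to fzero; suc to fsuc)
open import Data.Fin.Properties using (_≟_; suc-injective; 0≢1+n)
open import Data.Product using (_×_; Σ; _,_; proj₁; proj₂)
open import Data.Empty using (⊥-elim)
open import Relation.Nullary using (¬_; Dec; yes; no)
open import Relation.Nullary.Decidable using (_×-dec_)
open import Relation.Binary using (Rel; Decidable; IsPartialOrder; Reflexive; Transitive)
open import Relation.Binary.PropositionalEquality using (_≡_)
import Relation.Binary.PropositionalEquality as ≡

module _ {c ℓ} (F : CharZeroField c ℓ) where
  open CharZeroField F
  open Incidence F
  open import Algebra.Properties.Semiring.Sum semiring
    using (sum; sum-cong-≋; sum-replicate-zero; ∑-distrib-+; ∑-comm; *-distribˡ-sum; *-distribʳ-sum)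
  open import Relation.Binary.Reasoning.Setoid setoid

  -- ∑ and the library's sum unfold along the same recursion, but only once the length is known.
  ∑≡sum : ∀ {m} (f : Fin m → Carrier) → ∑ f ≡ sum f
  ∑≡sum {zero} f = ≡.refl
  ∑≡sum {suc m} f = ≡.cong (f fzero +_) (∑≡sum (λ i → f (fsuc i)))

  ∑-cong : ∀ {m} {f g : Fin m → Carrier} → (∀ i → f i ≈ g i) → ∑ f ≈ ∑ g
  ∑-cong {f = f} {g} f≈g rewrite ∑≡sum f | ∑≡sum g = sum-cong-≋ f≈g

  ∑-zero : ∀ {m} {f : Fin m → Carrier} → (∀ i → f i ≈ 0#) → ∑ f ≈ 0#
  ∑-zero {m} f≈0 = trans (∑-cong f≈0) (trans (reflexive (∑≡sum {m} (λ _ → 0#))) (sum-replicate-zero m))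

  ∑-+ : ∀ {m} (f g : Fin m → Carrier) → ∑ (λ i → f i + g i) ≈ ∑ f + ∑ g
  ∑-+ f g rewrite ∑≡sum (λ i → f i + g i) | ∑≡sum f | ∑≡sum g = ∑-distrib-+ f g

  *-distribˡ-∑ : ∀ {m} k (f : Fin m → Carrier) → k * ∑ f ≈ ∑ (λ i → k * f i)
  *-distribˡ-∑ k f rewrite ∑≡sum f | ∑≡sum (λ i → k * f i) = *-distribˡ-sum k f

  *-distribʳ-∑ : ∀ {m} k (f : Fin m → Carrier) → ∑ f * k ≈ ∑ (λ i → f i * k)
  *-distribʳ-∑ k f rewrite ∑≡sum f | ∑≡sum (λ i → f i * k) = *-distribʳ-sum k f

  ∑-swap : ∀ {m n} (f : Fin m → Fin n → Carrier) →
           ∑ (λ i → ∑ (f i)) ≈ ∑ (λ j → ∑ (λ i → f i j))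
  ∑-swap {m} {n} f = begin
    ∑ (λ i → ∑ (f i))               ≈⟨ ∑-cong (λ i → reflexive (∑≡sum (f i))) ⟩
    ∑ (λ i → sum (f i))             ≡⟨ ∑≡sum (λ i → sum (f i)) ⟩
    sum (λ i → sum (f i))           ≈⟨ ∑-comm f ⟩
    sum (λ j → sum (λ i → f i j))   ≡⟨ ≡.sym (∑≡sum (λ j → sum (λ i → f i j))) ⟩
    ∑ (λ j → sum (λ i → f i j))     ≈⟨ ∑-cong (λ j → reflexive (≡.sym (∑≡sum (λ i → f i j)))) ⟩
    ∑ (λ j → ∑ (λ i → f i j))       ∎

  module _ {p} {P : Set p} where

    when-yes : (d : Dec P) {x : Carrier} → P → when d x ≈ x
    when-yes (yes _) _ = refl
    when-yes (no ¬p) p = ⊥-elim (¬p p)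

    when-no : (d : Dec P) {x : Carrier} → ¬ P → when d x ≈ 0#
    when-no (yes p) ¬p = ⊥-elim (¬p p)
    when-no (no _) _ = refl

    when-cong : (d : Dec P) {x y : Carrier} → (P → x ≈ y) → when d x ≈ when d y
    when-cong (yes p) x≈y = x≈y p
    when-cong (no _) _ = refl

    when-+ : (d : Dec P) {x y : Carrier} → when d (x + y) ≈ when d x + when d y
    when-+ (yes _) = refl
    when-+ (no _) = sym (+-identityʳ 0#)

    when-*ˡ : (d : Dec P) {k x : Carrier} → when d (k * x) ≈ k * when d x
    when-*ˡ (yes _) = refl
    when-*ˡ (no _) {k} = sym (zeroʳ k)

    when-*ʳ : (d : Dec P) {x k : Carrier} → when d (x * k) ≈ when d x * k
    when-*ʳ (yes _) = refl
    when-*ʳ (no _) {k = k} = sym (zeroˡ k)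

    when≈*-when1 : (d : Dec P) {x : Carrier} → when d x ≈ x * when d 1#
    when≈*-when1 (yes _) {x} = sym (*-identityʳ x)
    when≈*-when1 (no _) {x} = sym (zeroʳ x)

    when-∑ : ∀ {m} (d : Dec P) (f : Fin m → Carrier) → when d (∑ f) ≈ ∑ (λ i → when d (f i))
    when-∑ (yes _) f = refl
    when-∑ {m} (no _) f = sym (∑-zero {m} (λ _ → refl))

    when-comm : ∀ {q} {Q : Set q} (d : Dec P) (e : Dec Q) {x : Carrier} →
                when d (when e x) ≈ when e (when d x)
    when-comm (yes _) (yes _) = refl
    when-comm (yes _) (no _) = refl
    when-comm (no _) (yes _) = refl
    when-comm (no _) (no _) = refl

    when-⇔ : ∀ {q} {Q : Set q} (d : Dec P) (e : Dec Q) {x : Carrier} →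
             (P → Q) → (Q → P) → when d x ≈ when e x
    when-⇔ (yes _) (yes _) _ _ = refl
    when-⇔ (yes p) (no ¬q) P⇒Q _ = ⊥-elim (¬q (P⇒Q p))
    when-⇔ (no ¬p) (yes q) _ Q⇒P = ⊥-elim (¬p (Q⇒P q))
    when-⇔ (no _) (no _) _ _ = refl

  when-× : ∀ {a b} {A : Set a} {B : Set b} (d : Dec (A × B)) (dA : Dec A) {x y : Carrier} →
           (¬ A → x ≈ 0#) → (¬ B → y ≈ 0#) → when d (x * y) ≈ x * y
  when-× (yes _) _ _ _ = refl
  when-× (no ¬ab) (yes a) {x} _ ¬B⇒y≈0 = sym (trans (*-congˡ (¬B⇒y≈0 (λ b → ¬ab (a , b)))) (zeroʳ x))
  when-× (no _) (no ¬a) {y = y} ¬A⇒x≈0 _ = sym (trans (*-congʳ (¬A⇒x≈0 ¬a)) (zeroˡ y))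

  ∑-when-unique : ∀ {m} {P : Fin m → Set} (d : ∀ i → Dec (P i)) (a : Fin m) →
                  (∀ i → P i → i ≡ a) → P a → (f : Fin m → Carrier) →
                  ∑ (λ i → when (d i) (f i)) ≈ f a
  ∑-when-unique d fzero only-a Pa f =
    trans (+-cong (when-yes (d fzero) Pa)
                  (∑-zero (λ i → when-no (d (fsuc i)) (λ Pi → 0≢1+n (≡.sym (only-a (fsuc i) Pi))))))
          (+-identityʳ (f fzero))
  ∑-when-unique d (fsuc a) only-a Pa f =
    trans (+-cong (when-no (d fzero) (λ P0 → 0≢1+n (only-a fzero P0)))
                  (∑-when-unique (λ i → d (fsuc i)) a (λ i Pi → suc-injective (only-a (fsuc i) Pi)) Pa
                                 (λ i → f (fsuc i))))
          (+-identityˡ (f (fsuc a)))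

  natCast-count : ∀ {m} {P : Fin m → Set} (d : ∀ i → Dec (P i)) →
                  natCast commutativeRing (count d) ≈ ∑ (λ i → when (d i) 1#)
  natCast-count {zero} d = refl
  natCast-count {suc m} d with d fzero
  ... | yes _ = +-congˡ (natCast-count (λ i → d (fsuc i)))
  ... | no _ = trans (natCast-count (λ i → d (fsuc i))) (sym (+-identityˡ _))

  count-witness⇒suc : ∀ {m} {P : Fin m → Set} (d : ∀ i → Dec (P i)) (i : Fin m) → P i →
                      Σ ℕ (λ k → count d ≡ suc k)
  count-witness⇒suc {suc m} d i Pi with d fzero
  count-witness⇒suc {suc m} d i Pi | yes _ = _ , ≡.refl
  count-witness⇒suc {suc m} d fzero Pi | no ¬P0 = ⊥-elim (¬P0 Pi)
  count-witness⇒suc {suc m} d (fsuc i) Pi | no _ = count-witness⇒suc (λ j → d (fsuc j)) i Pi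

  ⁻¹-cancel : ∀ x y → ¬ (x ≈ 0#) → (x ⁻¹) * (y * x) ≈ y
  ⁻¹-cancel x y x≉0 = begin
    (x ⁻¹) * (y * x)  ≈⟨ *-congˡ (*-comm y x) ⟩
    (x ⁻¹) * (x * y)  ≈⟨ sym (*-assoc _ _ _) ⟩
    ((x ⁻¹) * x) * y  ≈⟨ *-congʳ (*-comm _ _) ⟩
    (x * (x ⁻¹)) * y  ≈⟨ *-congʳ (⁻¹-inverse x x≉0) ⟩
    1# * y            ≈⟨ *-identityˡ y ⟩
    y                 ∎

  matMul : ∀ {m} → Fun m → Fun m → Fun m
  matMul g h a c = ∑ (λ b → g a b * h b c)

  module Fibers {m n} (φ : Fin m → Fin n) where

    fiberSum : Fun m → Fin n → Fin m → Carrier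
    fiberSum h q p' = ∑ (λ p → when (φ p ≟ q) (h p p'))

    FiberConstant : Fun m → Set ℓ
    FiberConstant h = ∀ q q' p₁ p₂ → φ p₁ ≡ q' → φ p₂ ≡ q' → fiberSum h q p₁ ≈ fiberSum h q p₂

    fiberSum-cong : ∀ {g h} → g ≋ h → ∀ q p' → fiberSum g q p' ≈ fiberSum h q p'
    fiberSum-cong g≋h q p' = ∑-cong (λ p → when-cong (φ p ≟ q) (λ _ → g≋h p p'))

    fiberSum-⊕ : ∀ g h q p' → fiberSum (g ⊕ h) q p' ≈ fiberSum g q p' + fiberSum h q p'
    fiberSum-⊕ g h q p' = trans (∑-cong (λ p → when-+ (φ p ≟ q)))
                                (∑-+ (λ p → when (φ p ≟ q) (g p p')) (λ p → when (φ p ≟ q) (h p p')))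

    fiberSum-· : ∀ k h q p' → fiberSum (k · h) q p' ≈ k * fiberSum h q p'
    fiberSum-· k h q p' = trans (∑-cong (λ p → when-*ˡ (φ p ≟ q)))
                                (sym (*-distribˡ-∑ k (λ p → when (φ p ≟ q) (h p p'))))

    fiberSum-δ : ∀ q p' → fiberSum δ q p' ≈ when (φ p' ≟ q) 1#
    fiberSum-δ q p' = trans (∑-cong (λ p → when-comm (φ p ≟ q) (p ≟ p')))
                            (∑-when-unique (_≟ p') p' (λ _ p≡p' → p≡p') ≡.refl (λ p → when (φ p ≟ q) 1#))

    fiberSum-matMul : ∀ g h q p' → fiberSum (matMul g h) q p' ≈ ∑ (λ b → fiberSum g q b * h b p')
    fiberSum-matMul g h q p' = begin
      ∑ (λ p → when (φ p ≟ q) (∑ (λ b → g p b * h b p')))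
        ≈⟨ ∑-cong (λ p → when-∑ (φ p ≟ q) (λ b → g p b * h b p')) ⟩
      ∑ (λ p → ∑ (λ b → when (φ p ≟ q) (g p b * h b p')))
        ≈⟨ ∑-swap (λ p b → when (φ p ≟ q) (g p b * h b p')) ⟩
      ∑ (λ b → ∑ (λ p → when (φ p ≟ q) (g p b * h b p')))
        ≈⟨ ∑-cong {m} (λ b → ∑-cong {m} (λ p → when-*ʳ (φ p ≟ q))) ⟩
      ∑ (λ b → ∑ (λ p → when (φ p ≟ q) (g p b) * h b p'))
        ≈⟨ ∑-cong (λ b → sym (*-distribʳ-∑ (h b p') (λ p → when (φ p ≟ q) (g p b)))) ⟩
      ∑ (λ b → fiberSum g q b * h b p') ∎

    ∑-fibers : (f : Fin m → Carrier) → ∑ f ≈ ∑ (λ q → ∑ (λ p → when (φ p ≟ q) (f p)))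
    ∑-fibers f =
      trans (∑-cong (λ p → sym (∑-when-unique (φ p ≟_) (φ p) (λ _ e → ≡.sym e) ≡.refl (λ _ → f p))))
            (∑-swap (λ p q → when (φ p ≟ q) (f p)))

    fiberSize≉0 : ∀ {p q} → φ p ≡ q → ¬ (natCast commutativeRing (fiberSize φ q) ≈ 0#)
    fiberSize≉0 {p} {q} φp≡q with count-witness⇒suc (λ p → φ p ≟ q) p φp≡q
    ... | k , size≡1+k =
      ≡.subst (λ s → ¬ (natCast commutativeRing s ≈ 0#)) (≡.sym size≡1+k) (char-zero k)

    push-numerator : ∀ h q q' →
                     ∑ (λ p → ∑ (λ p' → when (φ p ≟ q) (when (φ p' ≟ q') (h p p'))))
                     ≈ ∑ (λ p' → when (φ p' ≟ q') (fiberSum h q p'))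
    push-numerator h q q' = begin
      ∑ (λ p → ∑ (λ p' → when (φ p ≟ q) (when (φ p' ≟ q') (h p p'))))
        ≈⟨ ∑-cong (λ p → ∑-cong (λ p' → when-comm (φ p ≟ q) (φ p' ≟ q'))) ⟩
      ∑ (λ p → ∑ (λ p' → when (φ p' ≟ q') (when (φ p ≟ q) (h p p'))))
        ≈⟨ ∑-swap (λ p p' → when (φ p' ≟ q') (when (φ p ≟ q) (h p p'))) ⟩
      ∑ (λ p' → ∑ (λ p → when (φ p' ≟ q') (when (φ p ≟ q) (h p p'))))
        ≈⟨ ∑-cong (λ p' → sym (when-∑ (φ p' ≟ q') (λ p → when (φ p ≟ q) (h p p')))) ⟩
      ∑ (λ p' → when (φ p' ≟ q') (fiberSum h q p')) ∎

    -- The double sum defining φ_* h (q, φ p) is |φ⁻¹(φ p)| copies of fiberSum h q p,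
    -- and characteristic zero makes that count invertible.
    push-fiberSum : ∀ {h} → FiberConstant h → ∀ {q q' p} → φ p ≡ q' → push φ h q q' ≈ fiberSum h q p
    push-fiberSum {h} const {q} {p = p} ≡.refl =
      trans (*-congˡ numerator≈) (⁻¹-cancel _ _ (fiberSize≉0 ≡.refl))
      where
        numerator≈ : ∑ (λ p₁ → ∑ (λ p' → when (φ p₁ ≟ q) (when (φ p' ≟ φ p) (h p₁ p'))))
                     ≈ fiberSum h q p * natCast commutativeRing (fiberSize φ (φ p))
        numerator≈ = begin
          _ ≈⟨ push-numerator h q (φ p) ⟩
          ∑ (λ p' → when (φ p' ≟ φ p) (fiberSum h q p'))
            ≈⟨ ∑-cong (λ p' → when-cong (φ p' ≟ φ p) (λ φp'≡φp → const q (φ p) p' p φp'≡φp ≡.refl)) ⟩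
          ∑ (λ p' → when (φ p' ≟ φ p) (fiberSum h q p))
            ≈⟨ ∑-cong (λ p' → when≈*-when1 (φ p' ≟ φ p)) ⟩
          ∑ (λ p' → fiberSum h q p * when (φ p' ≟ φ p) 1#)
            ≈⟨ sym (*-distribˡ-∑ (fiberSum h q p) (λ p' → when (φ p' ≟ φ p) 1#)) ⟩
          fiberSum h q p * ∑ (λ p' → when (φ p' ≟ φ p) 1#)
            ≈⟨ *-congˡ (sym (natCast-count (λ p' → φ p' ≟ φ p))) ⟩
          fiberSum h q p * natCast commutativeRing (fiberSize φ (φ p)) ∎

    FiberConstant-⊕ : ∀ {g h} → FiberConstant g → FiberConstant h → FiberConstant (g ⊕ h)
    FiberConstant-⊕ {g} {h} g-const h-const q q' p₁ p₂ e₁ e₂ = begin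
      fiberSum (g ⊕ h) q p₁              ≈⟨ fiberSum-⊕ g h q p₁ ⟩
      fiberSum g q p₁ + fiberSum h q p₁  ≈⟨ +-cong (g-const q q' p₁ p₂ e₁ e₂) (h-const q q' p₁ p₂ e₁ e₂) ⟩
      fiberSum g q p₂ + fiberSum h q p₂  ≈⟨ sym (fiberSum-⊕ g h q p₂) ⟩
      fiberSum (g ⊕ h) q p₂              ∎

    FiberConstant-· : ∀ k {h} → FiberConstant h → FiberConstant (k · h)
    FiberConstant-· k {h} h-const q q' p₁ p₂ e₁ e₂ = begin
      fiberSum (k · h) q p₁  ≈⟨ fiberSum-· k h q p₁ ⟩
      k * fiberSum h q p₁    ≈⟨ *-congˡ (h-const q q' p₁ p₂ e₁ e₂) ⟩
      k * fiberSum h q p₂    ≈⟨ sym (fiberSum-· k h q p₂) ⟩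
      fiberSum (k · h) q p₂  ∎

    FiberConstant-δ : FiberConstant δ
    FiberConstant-δ q q' p₁ p₂ e₁ e₂ = begin
      fiberSum δ q p₁       ≈⟨ fiberSum-δ q p₁ ⟩
      when (φ p₁ ≟ q) 1#    ≈⟨ when-⇔ (φ p₁ ≟ q) (φ p₂ ≟ q) (≡.trans (≡.trans e₂ (≡.sym e₁)))
                                                            (≡.trans (≡.trans e₁ (≡.sym e₂))) ⟩
      when (φ p₂ ≟ q) 1#    ≈⟨ sym (fiberSum-δ q p₂) ⟩
      fiberSum δ q p₂       ∎

  module _ {m} {_≼_ : Rel (Fin m) 0ℓ} where

    InI-δ : Reflexive _≼_ → InI _≼_ δ
    InI-δ refl≼ a c a⋠c = when-no (a ≟ c) (λ { ≡.refl → a⋠c refl≼ })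

    module _ (_≼?_ : Decidable _≼_) where

      conv≋matMul : ∀ {g h} → InI _≼_ g → InI _≼_ h → conv _≼?_ g h ≋ matMul g h
      conv≋matMul g∈I h∈I a c =
        ∑-cong (λ b → when-× ((a ≼? b) ×-dec (b ≼? c)) (a ≼? b) (g∈I a b) (h∈I b c))

      InI-conv : Transitive _≼_ → ∀ g h → InI _≼_ (conv _≼?_ g h)
      InI-conv trans≼ g h a c a⋠c =
        ∑-zero (λ b → when-no ((a ≼? b) ×-dec (b ≼? c)) (λ (a≼b , b≼c) → a⋠c (trans≼ a≼b b≼c)))

  module Pushforward {m n} {_≼P_ : Rel (Fin m) 0ℓ} {_≼Q_ : Rel (Fin n) 0ℓ}
    (≼P-isPartialOrder : IsPartialOrder _≡_ _≼P_) (_≼P?_ : Decidable _≼P_) (_≼Q?_ : Decidable _≼Q_)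
    (φ : Fin m → Fin n) (φ-mono : ∀ p p' → p ≼P p' → φ p ≼Q φ p')
    (φ-section : ∀ q → Σ (Fin m) (λ p → φ p ≡ q)) where

    open Fibers φ
    open IsPartialOrder ≼P-isPartialOrder using () renaming (refl to ≼P-refl; trans to ≼P-trans)

    rep : Fin n → Fin m
    rep q = proj₁ (φ-section q)

    φ∘rep : ∀ q → φ (rep q) ≡ q
    φ∘rep q = proj₂ (φ-section q)

    push≈fiberSum-rep : ∀ {h} → FiberConstant h → ∀ q q' → push φ h q q' ≈ fiberSum h q (rep q')
    push≈fiberSum-rep h-const q q' = push-fiberSum h-const (φ∘rep q')

    fiberSum-vanishes : ∀ {h} → InI _≼P_ h → ∀ {q q' p'} → φ p' ≡ q' → ¬ (q ≼Q q') →
                        fiberSum h q p' ≈ 0#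
    fiberSum-vanishes {h} h∈I {q} {p' = p'} ≡.refl q⋠φp' = ∑-zero term
      where
        term : ∀ p → when (φ p ≟ q) (h p p') ≈ 0#
        term p with φ p ≟ q
        ... | yes ≡.refl = h∈I p p' (λ p≼p' → q⋠φp' (φ-mono p p' p≼p'))
        ... | no _ = refl

    fiberSum-conv : ∀ {g h} → InI _≼P_ g → InI _≼P_ h → FiberConstant g → ∀ q p' →
                    fiberSum (conv _≼P?_ g h) q p' ≈ ∑ (λ q'' → fiberSum g q (rep q'') * fiberSum h q'' p')
    fiberSum-conv {g} {h} g∈I h∈I g-const q p' = begin
      fiberSum (conv _≼P?_ g h) q p'
        ≈⟨ fiberSum-cong (conv≋matMul _≼P?_ g∈I h∈I) q p' ⟩
      fiberSum (matMul g h) q p'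
        ≈⟨ fiberSum-matMul g h q p' ⟩
      ∑ (λ b → fiberSum g q b * h b p')
        ≈⟨ ∑-fibers (λ b → fiberSum g q b * h b p') ⟩
      ∑ (λ q'' → ∑ (λ b → when (φ b ≟ q'') (fiberSum g q b * h b p')))
        ≈⟨ ∑-cong (λ q'' → ∑-cong (λ b → when-cong (φ b ≟ q'')
              (λ φb≡q'' → *-congʳ (g-const q q'' b (rep q'') φb≡q'' (φ∘rep q''))))) ⟩
      ∑ (λ q'' → ∑ (λ b → when (φ b ≟ q'') (fiberSum g q (rep q'') * h b p')))
        ≈⟨ ∑-cong (λ q'' → ∑-cong (λ b → when-*ˡ (φ b ≟ q''))) ⟩
      ∑ (λ q'' → ∑ (λ b → fiberSum g q (rep q'') * when (φ b ≟ q'') (h b p')))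
        ≈⟨ ∑-cong (λ q'' → sym (*-distribˡ-∑ (fiberSum g q (rep q'')) (λ b → when (φ b ≟ q'') (h b p')))) ⟩
      ∑ (λ q'' → fiberSum g q (rep q'') * fiberSum h q'' p') ∎

    FiberConstant-conv : ∀ {g h} → InI _≼P_ g → InI _≼P_ h → FiberConstant g → FiberConstant h →
                         FiberConstant (conv _≼P?_ g h)
    FiberConstant-conv {g} {h} g∈I h∈I g-const h-const q q' p₁ p₂ e₁ e₂ = begin
      fiberSum (conv _≼P?_ g h) q p₁                        ≈⟨ fiberSum-conv g∈I h∈I g-const q p₁ ⟩
      ∑ (λ q'' → fiberSum g q (rep q'') * fiberSum h q'' p₁)
        ≈⟨ ∑-cong (λ q'' → *-congˡ (h-const q'' q' p₁ p₂ e₁ e₂)) ⟩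
      ∑ (λ q'' → fiberSum g q (rep q'') * fiberSum h q'' p₂) ≈⟨ sym (fiberSum-conv g∈I h∈I g-const q p₂) ⟩
      fiberSum (conv _≼P?_ g h) q p₂                        ∎

    Iφ-zero : InIφ _≼P_ φ zeroF
    Iφ-zero = (λ _ _ _ → refl) , (λ _ _ _ _ _ _ → refl)

    Iφ-⊕ : ∀ g h → InIφ _≼P_ φ g → InIφ _≼P_ φ h → InIφ _≼P_ φ (g ⊕ h)
    Iφ-⊕ g h (g∈I , g-const) (h∈I , h-const) =
      (λ a c a⋠c → trans (+-cong (g∈I a c a⋠c) (h∈I a c a⋠c)) (+-identityʳ 0#)) ,
      FiberConstant-⊕ g-const h-const

    Iφ-· : ∀ k h → InIφ _≼P_ φ h → InIφ _≼P_ φ (k · h)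
    Iφ-· k h (h∈I , h-const) =
      (λ a c a⋠c → trans (*-congˡ (h∈I a c a⋠c)) (zeroʳ k)) , FiberConstant-· k h-const

    Iφ-δ : InIφ _≼P_ φ δ
    Iφ-δ = InI-δ ≼P-refl , FiberConstant-δ

    Iφ-conv : ∀ g h → InIφ _≼P_ φ g → InIφ _≼P_ φ h → InIφ _≼P_ φ (conv _≼P?_ g h)
    Iφ-conv g h (g∈I , g-const) (h∈I , h-const) =
      InI-conv _≼P?_ ≼P-trans g h , FiberConstant-conv g∈I h∈I g-const h-const

    push-InI : ∀ h → InIφ _≼P_ φ h → InI _≼Q_ (push φ h)
    push-InI h (h∈I , h-const) q q' q⋠q' =
      trans (push≈fiberSum-rep h-const q q') (fiberSum-vanishes h∈I (φ∘rep q') q⋠q')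

    push-⊕ : ∀ g h → InIφ _≼P_ φ g → InIφ _≼P_ φ h → push φ (g ⊕ h) ≋ (push φ g ⊕ push φ h)
    push-⊕ g h g∈Iφ h∈Iφ q q' = begin
      push φ (g ⊕ h) q q'                       ≈⟨ push≈fiberSum-rep (proj₂ (Iφ-⊕ g h g∈Iφ h∈Iφ)) q q' ⟩
      fiberSum (g ⊕ h) q (rep q')               ≈⟨ fiberSum-⊕ g h q (rep q') ⟩
      fiberSum g q (rep q') + fiberSum h q (rep q')
        ≈⟨ sym (+-cong (push≈fiberSum-rep (proj₂ g∈Iφ) q q') (push≈fiberSum-rep (proj₂ h∈Iφ) q q')) ⟩
      push φ g q q' + push φ h q q'             ∎

    push-· : ∀ k h → InIφ _≼P_ φ h → push φ (k · h) ≋ (k · push φ h)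
    push-· k h h∈Iφ q q' = begin
      push φ (k · h) q q'        ≈⟨ push≈fiberSum-rep (proj₂ (Iφ-· k h h∈Iφ)) q q' ⟩
      fiberSum (k · h) q (rep q') ≈⟨ fiberSum-· k h q (rep q') ⟩
      k * fiberSum h q (rep q')   ≈⟨ *-congˡ (sym (push≈fiberSum-rep (proj₂ h∈Iφ) q q')) ⟩
      k * push φ h q q'           ∎

    push-δ : push φ δ ≋ δ
    push-δ q q' = begin
      push φ δ q q'              ≈⟨ push≈fiberSum-rep FiberConstant-δ q q' ⟩
      fiberSum δ q (rep q')      ≈⟨ fiberSum-δ q (rep q') ⟩
      when (φ (rep q') ≟ q) 1#   ≈⟨ when-⇔ (φ (rep q') ≟ q) (q ≟ q') (λ e → ≡.trans (≡.sym e) (φ∘rep q'))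
                                                                     (λ e → ≡.trans (φ∘rep q') (≡.sym e)) ⟩
      δ q q'                     ∎

    push-conv : ∀ g h → InIφ _≼P_ φ g → InIφ _≼P_ φ h →
                push φ (conv _≼P?_ g h) ≋ conv _≼Q?_ (push φ g) (push φ h)
    push-conv g h g∈Iφ@(g∈I , g-const) h∈Iφ@(h∈I , h-const) q q' = begin
      push φ (conv _≼P?_ g h) q q'
        ≈⟨ push≈fiberSum-rep (proj₂ (Iφ-conv g h g∈Iφ h∈Iφ)) q q' ⟩
      fiberSum (conv _≼P?_ g h) q (rep q')
        ≈⟨ fiberSum-conv g∈I h∈I g-const q (rep q') ⟩
      ∑ (λ q'' → fiberSum g q (rep q'') * fiberSum h q'' (rep q'))
        ≈⟨ ∑-cong (λ q'' → sym (when-× ((q ≼Q? q'') ×-dec (q'' ≼Q? q')) (q ≼Q? q'')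
                                   (fiberSum-vanishes g∈I (φ∘rep q'')) (fiberSum-vanishes h∈I (φ∘rep q')))) ⟩
      ∑ (λ q'' → when ((q ≼Q? q'') ×-dec (q'' ≼Q? q')) (fiberSum g q (rep q'') * fiberSum h q'' (rep q')))
        ≈⟨ ∑-cong (λ q'' → when-cong ((q ≼Q? q'') ×-dec (q'' ≼Q? q')) (λ _ →
              sym (*-cong (push≈fiberSum-rep g-const q q'') (push≈fiberSum-rep h-const q'' q')))) ⟩
      conv _≼Q?_ (push φ g) (push φ h) q q' ∎

proposition4p1 :
    ∀ {c ℓ} (F : CharZeroField c ℓ) →
    let open CharZeroField F in
    let open Incidence F in
    (m n : ℕ) (_≼P_ : Rel (Fin m) 0ℓ) (_≼Q_ : Rel (Fin n) 0ℓ) →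
    IsPartialOrder _≡_ _≼P_ → IsPartialOrder _≡_ _≼Q_ →
    (_≼P?_ : Decidable _≼P_) (_≼Q?_ : Decidable _≼Q_) →
    (φ : Fin m → Fin n) →
    (∀ p p' → p ≼P p' → φ p ≼Q φ p') →
    (∀ q → Σ (Fin m) (λ p → φ p ≡ q)) →
    -- I_φ(P) is a subalgebra of I(P)
    ( InIφ _≼P_ φ zeroF
    × (∀ g h → InIφ _≼P_ φ g → InIφ _≼P_ φ h → InIφ _≼P_ φ (g ⊕ h))
    × (∀ k h → InIφ _≼P_ φ h → InIφ _≼P_ φ (k · h))
    × InIφ _≼P_ φ δ
    × (∀ g h → InIφ _≼P_ φ g → InIφ _≼P_ φ h → InIφ _≼P_ φ (conv _≼P?_ g h)) )
    ×
    -- φ_* : I_φ(P) → I(Q) is an algebra map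
    ( (∀ h → InIφ _≼P_ φ h → InI _≼Q_ (push φ h))
    × (∀ g h → InIφ _≼P_ φ g → InIφ _≼P_ φ h → push φ (g ⊕ h) ≋ (push φ g ⊕ push φ h))
    × (∀ k h → InIφ _≼P_ φ h → push φ (k · h) ≋ (k · push φ h))
    × (push φ δ ≋ δ)
    × (∀ g h → InIφ _≼P_ φ g → InIφ _≼P_ φ h →
         push φ (conv _≼P?_ g h) ≋ conv _≼Q?_ (push φ g) (push φ h)) )
proposition4p1 F m n _≼P_ _≼Q_ ≼P-isPartialOrder _ _≼P?_ _≼Q?_ φ φ-mono φ-section =
  (Iφ-zero , Iφ-⊕ , Iφ-· , Iφ-δ , Iφ-conv) , (push-InI , push-⊕ , push-· , push-δ , push-conv)
  where open Pushforward F ≼P-isPartialOrder _≼P?_ _≼Q?_ φ φ-mono φ-section
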